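{- For every pair of integers $k\geq 3$ and $t\geq 3$ there exists a connected graph $H_n$ on $n = k\cdot t$ vertices with minimum degree $\delta(H_n) = \frac{n-k}{k}$ and exactly $k-1$ cut edges.
   Context: All graphs are finite, simple and undirected; a cut edge is an edge whose removal disconnects the graph. -}

module Defs where

open import Data.Nat using (ℕ; zero; suc; _<_)
open import Data.Fin using (Fin; toℕ)
open import Data.Bool using (Bool; true; false; _∧_; not)
open import Data.List using (List; length; filter; [])
open import Data.List.Base using (_∷_)
open import Data.List.Membership.Propositional using (_∈_)
open import Data.List.Relation.Unary.Unique.Propositional using (Unique)
open import Data.Vec.Functional using ()
open import Data.List using (allFin)
open import Data.Product using (Σ; _×_; _,_)
open import Relation.Binary.PropositionalEquality using (_≡_; _≢_)
open import Relation.Nullary using (¬_)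
open import Relation.Nullary.Decidable using (⌊_⌋)
open import Data.Fin.Properties using (_≟_)

record Graph (n : ℕ) : Set where
  field
    adj   : Fin n → Fin n → Bool
    sym   : ∀ u v → adj u v ≡ adj v u
    irrefl : ∀ v → adj v v ≡ false
open Graph public

data Walk {n : ℕ} (A : Fin n → Fin n → Bool) : Fin n → Fin n → Set where
  here  : ∀ {u} → Walk A u u
  step  : ∀ {u w v} → A u w ≡ true → Walk A w v → Walk A u v

ConnectedAdj : {n : ℕ} → (Fin n → Fin n → Bool) → Set
ConnectedAdj A = ∀ u v → Walk A u v

Connected : {n : ℕ} → Graph n → Set
Connected G = ConnectedAdj (adj G)

deleteEdge : {n : ℕ} → Graph n → Fin n → Fin n → (Fin n → Fin n → Bool)
deleteEdge G a b u v =
  adj G u v ∧ not ((⌊ u ≟ a ⌋ ∧ ⌊ v ≟ b ⌋) Data.Bool.∨ (⌊ u ≟ b ⌋ ∧ ⌊ v ≟ a ⌋))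
  where import Data.Bool

-- Edges are represented as pairs (a , b) with a < b (each edge exactly once).
Edge : {n : ℕ} → Graph n → Fin n × Fin n → Set
Edge G (a , b) = (toℕ a < toℕ b) × (adj G a b ≡ true)

IsCutEdge : {n : ℕ} → Graph n → Fin n × Fin n → Set
IsCutEdge G (a , b) = Edge G (a , b) × ¬ ConnectedAdj (deleteEdge G a b)

HasExactlyCutEdges : {n : ℕ} → Graph n → ℕ → Set
HasExactlyCutEdges G m =
  Σ (List _) λ es →
    Unique es × (length es ≡ m) ×
    (∀ e → e ∈ es → IsCutEdge G e) × (∀ e → IsCutEdge G e → e ∈ es)

degree : {n : ℕ} → Graph n → Fin n → ℕ
degree G v = length (filter (λ u → adj G v u Data.Bool.≟ true) (allFin _))
  where import Data.Bool

MinDegree : {n : ℕ} → Graph n → ℕ → Set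
MinDegree G d = (∀ v → d Data.Nat.≤ degree G v) × Σ _ (λ v → degree G v ≡ d)
  where import Data.Nat

module Submission where

-- The graph H_n of Theorem 3.2 is built from k cliques K_t (the blocks
-- B₀, …, B_{k-1}, block B holding the vertices B·t, …, B·t + t - 1)
-- together with the Hamiltonian path 0 – 1 – … – (kt - 1).  Inside a block
-- the path edges are clique edges already, so the only new edges are the
-- k - 1 "boundary" edges {B·t + t - 1, (B+1)·t} joining consecutive blocks.
--
-- The construction then proves, for any k ≥ 1 and block size t:
--   connectivity (from the path); minimum degree t - 1 when t ≥ 2
--   (every vertex sees its t - 1 block-mates, vertex 0 sees nothing else);
--   and, when t ≥ 3, the cut edges are exactly the k - 1 boundary edges:
--   a block edge lies on a triangle inside its block, and deleting a
--   boundary edge leaves no edge leaving the vertices below (B+1)·t.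
-- Theorem 3.2 is the case k, t ≥ 3, where (kt - k) / k = t - 1.

open import Defs renaming (sym to adj-sym)
open import Data.Nat using (ℕ; zero; suc; _≤_; _<_; _*_; _+_; _∸_; _/_; _%_; s≤s; z≤n; z<s; NonZero; >-nonZero)
open import Data.Nat.Properties
open import Data.Nat.DivMod
open import Data.Nat.Divisibility using (divides-refl)
open import Data.Fin using (Fin; toℕ; fromℕ<) renaming (zero to fzero; suc to fsuc)
open import Data.Fin.Properties using (toℕ-fromℕ<; toℕ-injective; toℕ<n) renaming (_≟_ to _≟ᶠ_)
open import Data.Bool using (Bool; true; false; _∧_; _∨_; not; if_then_else_)
import Data.Bool as Bool
open import Data.Bool.Properties using (not-¬)
open import Data.Product using (Σ; _×_; _,_; proj₁; proj₂; ∃-syntax; map₂)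
open import Data.Sum using (_⊎_; inj₁; inj₂; [_,_])
open import Data.List using (List; length; filter; tabulate; allFin; map)
open import Data.List.Properties using (filter-accept; filter-reject; length-map; length-tabulate)
open import Data.List.Membership.Propositional using (_∈_)
open import Data.List.Membership.Propositional.Properties using (∈-map⁺; ∈-map⁻; ∈-allFin)
import Data.List.Relation.Unary.Unique.Propositional.Properties as Unique
open import Function using (_∘_; mk⇔)
open import Relation.Nullary using (¬_; Dec; yes; no; does; contradiction; ¬?; _×-dec_; _⊎-dec_)
open import Relation.Nullary.Decidable using (dec-true; dec-false; does-⇔; isYes≗does)
open import Relation.Binary.PropositionalEquality hiding ([_])

module _ {n : ℕ} {A : Fin n → Fin n → Bool} where

  _++ʷ_ : ∀ {u v w} → Walk A u v → Walk A v w → Walk A u w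
  here       ++ʷ q = q
  step e p   ++ʷ q = step e (p ++ʷ q)

  reverseʷ : (∀ u v → A u v ≡ A v u) → ∀ {u v} → Walk A u v → Walk A v u
  reverseʷ symA here                 = here
  reverseʷ symA (step {u} {w} e p) = reverseʷ symA p ++ʷ step (trans (symA w u) e) here

  -- A predicate preserved by every edge holds at the end of every walk;
  -- this is how we show that deleting an edge disconnects.
  walk-invariant : (S : Fin n → Set) → (∀ {x y} → A x y ≡ true → S x → S y) →
                   ∀ {u v} → Walk A u v → S u → S v
  walk-invariant S closed here       Su = Su
  walk-invariant S closed (step e p) Su = walk-invariant S closed p (closed e Su)

walk-map : ∀ {n} {A B : Fin n → Fin n → Bool} → (∀ x y → A x y ≡ true → Walk B x y) →
           ∀ {u v} → Walk A u v → Walk B u v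
walk-map reroute here               = here
walk-map reroute (step {u} {w} e p) = reroute u w e ++ʷ walk-map reroute p

-- A symmetric adjacency containing every path edge {i + 1, i} is connected:
-- walk from u down to vertex 0 and from there up to v.
path-connected : ∀ {n} (A : Fin n → Fin n → Bool) → (∀ u v → A u v ≡ A v u) →
                 (∀ u v → toℕ u ≡ suc (toℕ v) → A u v ≡ true) → ConnectedAdj A
path-connected {suc n} A symA path u v = down u ++ʷ reverseʷ symA (down v)
  where
  down-from : ∀ m (x : Fin (suc n)) → toℕ x ≡ m → Walk A x fzero
  down-from zero    x x≡0 = subst (λ y → Walk A y fzero) (sym (toℕ-injective x≡0)) here
  down-from (suc m) x x≡1+m =
    step (path x below (trans x≡1+m (cong suc (sym (toℕ-fromℕ< m<n)))))
         (down-from m below (toℕ-fromℕ< m<n))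
    where
    m<n : m < suc n
    m<n = <-trans (n<1+n m) (subst (_< suc n) x≡1+m (toℕ<n x))
    below : Fin (suc n)
    below = fromℕ< m<n

  down : ∀ x → Walk A x fzero
  down x = down-from (toℕ x) x refl

module _ {n : ℕ} where

  deleted? : (a b x y : Fin n) → Dec ((x ≡ a × y ≡ b) ⊎ (x ≡ b × y ≡ a))
  deleted? a b x y = (x ≟ᶠ a ×-dec y ≟ᶠ b) ⊎-dec (x ≟ᶠ b ×-dec y ≟ᶠ a)

  deleteEdge-spec : ∀ (G : Graph n) a b x y →
                    deleteEdge G a b x y ≡ adj G x y ∧ not (does (deleted? a b x y))
  deleteEdge-spec G a b x y =
    cong (λ d → adj G x y ∧ not d)
         (cong₂ _∨_ (cong₂ _∧_ (isYes≗does (x ≟ᶠ a)) (isYes≗does (y ≟ᶠ b)))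
                    (cong₂ _∧_ (isYes≗does (x ≟ᶠ b)) (isYes≗does (y ≟ᶠ a))))

  deleteEdge-keeps : ∀ (G : Graph n) {a b x y} → adj G x y ≡ true →
                     ¬ (x ≡ a × y ≡ b) → ¬ (x ≡ b × y ≡ a) → deleteEdge G a b x y ≡ true
  deleteEdge-keeps G {a} {b} {x} {y} xy ¬ab ¬ba = begin
    deleteEdge G a b x y                           ≡⟨ deleteEdge-spec G a b x y ⟩
    adj G x y ∧ not (does (deleted? a b x y))      ≡⟨ cong₂ (λ p d → p ∧ not d) xy
                                                         (dec-false (deleted? a b x y) [ ¬ab , ¬ba ]) ⟩
    true                                           ∎
    where open ≡-Reasoning

  deleteEdge-sound : ∀ (G : Graph n) {a b x y} → deleteEdge G a b x y ≡ true →
                     adj G x y ≡ true × ¬ (x ≡ a × y ≡ b)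
  deleteEdge-sound G {a} {b} {x} {y} e =
    map₂ (_∘ inj₁) (surviving (adj G x y) (deleted? a b x y) (trans (sym (deleteEdge-spec G a b x y)) e))
    where
    surviving : ∀ {P : Set} b (d : Dec P) → b ∧ not (does d) ≡ true → b ≡ true × ¬ P
    surviving true  (no ¬p) _ = refl , ¬p
    surviving true  (yes _) ()
    surviving false _       ()

  -- An edge lying on a triangle a – w – b is not a cut edge: every use of
  -- the edge {a , b} in a walk is replaced by the detour through w.
  triangle-edge-not-cut : ∀ (G : Graph n) {a b w} → Connected G →
                          adj G a w ≡ true → adj G w b ≡ true → w ≢ a → w ≢ b →
                          ConnectedAdj (deleteEdge G a b)
  triangle-edge-not-cut G {a} {b} {w} connected aw wb w≢a w≢b u v = walk-map reroute (connected u v)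
    where
    edge : ∀ {x y} → adj G x y ≡ true → ¬ (x ≡ a × y ≡ b) → ¬ (x ≡ b × y ≡ a) →
           Walk (deleteEdge G a b) x y
    edge xy ¬ab ¬ba = step (deleteEdge-keeps G xy ¬ab ¬ba) here

    a→w→b : Walk (deleteEdge G a b) a b
    a→w→b = edge aw (w≢b ∘ proj₂) (w≢a ∘ proj₂) ++ʷ edge wb (w≢a ∘ proj₁) (w≢b ∘ proj₁)

    b→w→a : Walk (deleteEdge G a b) b a
    b→w→a = edge (trans (adj-sym G b w) wb) (w≢b ∘ proj₂) (w≢a ∘ proj₂)
         ++ʷ edge (trans (adj-sym G w a) aw) (w≢a ∘ proj₁) (w≢b ∘ proj₁)

    reroute : ∀ x y → adj G x y ≡ true → Walk (deleteEdge G a b) x y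
    reroute x y xy with x ≟ᶠ a ×-dec y ≟ᶠ b | x ≟ᶠ b ×-dec y ≟ᶠ a
    ... | yes (refl , refl) | _                = a→w→b
    ... | no _              | yes (refl , refl) = b→w→a
    ... | no ¬ab            | no ¬ba           = edge xy ¬ab ¬ba

indicator : Bool → ℕ
indicator b = if b then 1 else 0

count : (ℕ → Bool) → ℕ → ℕ
count h zero    = 0
count h (suc n) = indicator (h 0) + count (h ∘ suc) n

count-all : ∀ n h → (∀ j → j < n → h j ≡ true) → count h n ≡ n
count-all zero    h all = refl
count-all (suc n) h all rewrite all 0 z<s =
  cong suc (count-all n (h ∘ suc) (λ j j<n → all (suc j) (s≤s j<n)))

count-none : ∀ n h → (∀ j → j < n → h j ≡ false) → count h n ≡ 0
count-none zero    h none = refl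
count-none (suc n) h none rewrite none 0 z<s =
  count-none n (h ∘ suc) (λ j j<n → none (suc j) (s≤s j<n))

count-++ : ∀ a b h → count h (a + b) ≡ count h a + count (λ j → h (a + j)) b
count-++ zero    b h = refl
count-++ (suc a) b h =
  trans (cong (indicator (h 0) +_) (count-++ a b (h ∘ suc)))
        (sym (+-assoc (indicator (h 0)) (count (h ∘ suc) a) _))

count-window : ∀ s l n h → s + l ≤ n → count (λ j → h (s + j)) l ≤ count h n
count-window s l n h s+l≤n = begin
  count (λ j → h (s + j)) l                                         ≤⟨ m≤m+n _ _ ⟩
  count (λ j → h (s + j)) l + count (λ j → h (s + (l + j))) r       ≡⟨ count-++ l r (λ j → h (s + j)) ⟨
  count (λ j → h (s + j)) (l + r)                                   ≤⟨ m≤n+m _ (count h s) ⟩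
  count h s + count (λ j → h (s + j)) (l + r)                       ≡⟨ count-++ s (l + r) h ⟨
  count h (s + (l + r))                                             ≡⟨ cong (count h) s+[l+r]≡n ⟩
  count h n                                                         ∎
  where
  open ≤-Reasoning
  r = n ∸ (s + l)
  s+[l+r]≡n : s + (l + r) ≡ n
  s+[l+r]≡n = trans (sym (+-assoc s l r)) (m+[n∸m]≡n s+l≤n)

count-all-but-one : ∀ n h x → (∀ j → j < n → j ≢ x → h j ≡ true) → n ∸ 1 ≤ count h n
count-all-but-one zero          h x       others = z≤n
count-all-but-one (suc n)       h zero    others = begin
  n                   ≡⟨ count-all n (h ∘ suc) (λ j j<n → others (suc j) (s≤s j<n) (λ ())) ⟨
  count (h ∘ suc) n   ≤⟨ m≤n+m _ (indicator (h 0)) ⟩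
  count h (suc n)     ∎
  where open ≤-Reasoning
count-all-but-one (suc zero)    h (suc x) others = z≤n
count-all-but-one (suc (suc n)) h (suc x) others rewrite others 0 z<s (λ ()) =
  s≤s (count-all-but-one (suc n) (h ∘ suc) x
        (λ j j<n j≢x → others (suc j) (s≤s j<n) (j≢x ∘ suc-injective)))

filter-tabulate-count : ∀ {m n} (g : Fin m → Bool) (f : Fin n → Fin m) (h : ℕ → Bool) →
                        (∀ i → g (f i) ≡ h (toℕ i)) →
                        length (filter (λ u → g u Bool.≟ true) (tabulate f)) ≡ count h n
filter-tabulate-count {n = zero}  g f h agree = refl
filter-tabulate-count {n = suc n} g f h agree with h 0 in h0
... | true  = trans (cong length (filter-accept (λ u → g u Bool.≟ true) (trans (agree fzero) h0)))
                    (cong suc (filter-tabulate-count g (f ∘ fsuc) (h ∘ suc) (agree ∘ fsuc)))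
... | false = trans (cong length (filter-reject (λ u → g u Bool.≟ true) (not-¬ (trans (agree fzero) h0))))
                    (filter-tabulate-count g (f ∘ fsuc) (h ∘ suc) (agree ∘ fsuc))

degree-count : ∀ {n} (G : Graph n) (h : ℕ → ℕ → Bool) →
               (∀ u v → adj G u v ≡ h (toℕ u) (toℕ v)) → ∀ v → degree G v ≡ count (h (toℕ v)) n
degree-count G h adj≡h v = filter-tabulate-count (adj G v) (λ u → u) (h (toℕ v)) (adj≡h v)

does-true : ∀ {P : Set} (d : Dec P) → does d ≡ true → P
does-true (yes p) _ = p
does-true (no _)  ()

-- Among 0, 1, 2 some number differs from both x and y; this is where a
-- block of size t ≥ 3 provides the third vertex of a triangle.
avoid-two : ∀ x y → ∃[ j ] (j < 3 × j ≢ x × j ≢ y)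
avoid-two zero          zero          = 1 , s≤s (s≤s z≤n) , (λ ()) , (λ ())
avoid-two zero          (suc zero)    = 2 , ≤-refl , (λ ()) , (λ ())
avoid-two zero          (suc (suc _)) = 1 , s≤s (s≤s z≤n) , (λ ()) , (λ ())
avoid-two (suc zero)    zero          = 2 , ≤-refl , (λ ()) , (λ ())
avoid-two (suc (suc _)) zero          = 1 , s≤s (s≤s z≤n) , (λ ()) , (λ ())
avoid-two (suc _)       (suc _)       = 0 , z<s , (λ ()) , (λ ())

module BlockPath (k₁ t₁ : ℕ) where

  k t N : ℕ
  k = suc k₁
  t = suc t₁
  N = k * t

  position : ∀ u → u ≡ u / t * t + u % t
  position u = trans (m≡m%n+[m/n]*n u t) (+-comm (u % t) (u / t * t))

  offset-unique : ∀ u j → u ≡ u / t * t + j → j ≡ u % t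
  offset-unique u j u≡ = +-cancelˡ-≡ (u / t * t) j (u % t) (trans (sym u≡) (position u))

  block-of : ∀ B j → j < t → (B * t + j) / t ≡ B
  block-of B j j<t = begin
    (B * t + j) / t       ≡⟨ +-distrib-/-∣ˡ j (divides-refl B) ⟩
    B * t / t + j / t     ≡⟨ cong₂ _+_ (m*n/n≡m B t) (m<n⇒m/n≡0 j<t) ⟩
    B + 0                 ≡⟨ +-identityʳ B ⟩
    B                     ∎
    where open ≡-Reasoning

  block-fits : ∀ B → B < k → B * t + t ≤ N
  block-fits B B<k = subst (_≤ N) (+-comm t (B * t)) (*-monoˡ-≤ t B<k)

  Adjacent : ℕ → ℕ → Set
  Adjacent u v = u ≡ suc v ⊎ v ≡ suc u ⊎ (u / t ≡ v / t × u ≢ v)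

  pattern path-down p     = inj₁ p
  pattern path-up p       = inj₂ (inj₁ p)
  pattern same-block b u≢v = inj₂ (inj₂ (b , u≢v))

  adjacent? : ∀ u v → Dec (Adjacent u v)
  adjacent? u v = u ≟ suc v ⊎-dec v ≟ suc u ⊎-dec (u / t ≟ v / t ×-dec ¬? (u ≟ v))

  adjacent-sym : ∀ {u v} → Adjacent u v → Adjacent v u
  adjacent-sym (path-down p)       = path-up p
  adjacent-sym (path-up p)         = path-down p
  adjacent-sym (same-block b u≢v)  = same-block (sym b) (u≢v ∘ sym)

  adjacent-irrefl : ∀ {u} → ¬ Adjacent u u
  adjacent-irrefl (path-down p)      = 1+n≢n (sym p)
  adjacent-irrefl (path-up p)        = 1+n≢n (sym p)
  adjacent-irrefl (same-block _ u≢u) = u≢u refl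

  A : ℕ → ℕ → Bool
  A u v = does (adjacent? u v)

  adjacent-witness : ∀ {u v} → A u v ≡ true → Adjacent u v
  adjacent-witness {u} {v} = does-true (adjacent? u v)

  G : Graph N
  G = record
    { adj    = λ u v → A (toℕ u) (toℕ v)
    ; sym    = λ u v → does-⇔ (mk⇔ adjacent-sym adjacent-sym)
                                (adjacent? (toℕ u) (toℕ v)) (adjacent? (toℕ v) (toℕ u))
    ; irrefl = λ v → dec-false (adjacent? (toℕ v) (toℕ v)) adjacent-irrefl
    }

  edge : ∀ {u v : Fin N} → Adjacent (toℕ u) (toℕ v) → adj G u v ≡ true
  edge {u} {v} = dec-true (adjacent? (toℕ u) (toℕ v))

  connected : Connected G
  connected = path-connected (adj G) (adj-sym G) (λ u v → edge ∘ path-down)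

  degree-as-count : ∀ v → degree G v ≡ count (A (toℕ v)) N
  degree-as-count = degree-count G A (λ _ _ → refl)

  -- Every vertex is adjacent to the t - 1 other vertices of its block.
  degree-≥ : ∀ v → t₁ ≤ degree G v
  degree-≥ v = begin
    t₁                                  ≤⟨ count-all-but-one t (λ j → A u (B * t + j)) (u % t) block-mates ⟩
    count (λ j → A u (B * t + j)) t     ≤⟨ count-window (B * t) t N (A u) (block-fits B (m<n*o⇒m/o<n (toℕ<n v))) ⟩
    count (A u) N                       ≡⟨ degree-as-count v ⟨
    degree G v                          ∎
    where
    open ≤-Reasoning
    u = toℕ v
    B = u / t
    block-mates : ∀ j → j < t → j ≢ u % t → A u (B * t + j) ≡ true
    block-mates j j<t j≢u%t = dec-true (adjacent? u (B * t + j))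
      (same-block (sym (block-of B j j<t))
                  (λ u≡ → j≢u%t (offset-unique u j u≡)))

  -- For t ≥ 2 vertex 0 has no neighbour outside its block (its path
  -- neighbour 1 lies in the block), so its degree is exactly t - 1.
  degree-zero : 2 ≤ t → degree G fzero ≡ t₁
  degree-zero 2≤t = begin
    degree G fzero                                    ≡⟨ degree-as-count fzero ⟩
    count (A 0) (t + k₁ * t)                          ≡⟨ count-++ t (k₁ * t) (A 0) ⟩
    count (A 0) t + count (λ j → A 0 (t + j)) (k₁ * t) ≡⟨ cong₂ _+_ first-block (count-none (k₁ * t) _ (λ j _ → outside j)) ⟩
    t₁ + 0                                            ≡⟨ +-identityʳ t₁ ⟩
    t₁                                                ∎
    where
    open ≡-Reasoning
    first-block : count (A 0) t ≡ t₁
    first-block rewrite dec-false (adjacent? 0 0) adjacent-irrefl =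
      count-all t₁ (A 0 ∘ suc) (λ j j<t₁ → dec-true (adjacent? 0 (suc j))
        (same-block (trans (0/n≡0 t) (sym (m<n⇒m/n≡0 (s≤s j<t₁)))) (λ ())))
    outside : ∀ j → A 0 (t + j) ≡ false
    outside j = dec-false (adjacent? 0 (t + j)) λ
      { (path-down ())
      ; (path-up t+j≡1)   → <⇒≢ (≤-trans 2≤t (m≤m+n t j)) (sym t+j≡1)
      ; (same-block b _)  → <⇒≢ (m≥n⇒m/n>0 (m≤m+n t j)) (trans (sym (0/n≡0 t)) b)
      }

  min-degree : 2 ≤ t → MinDegree G t₁
  min-degree 2≤t = degree-≥ , fzero , degree-zero 2≤t

  -- The boundary edge after block B joins its last vertex lo B to the
  -- first vertex hi B of the next block.
  lo hi : ℕ → ℕ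
  lo B = B * t + t₁
  hi B = suc B * t

  suc-lo : ∀ B → suc (lo B) ≡ hi B
  suc-lo B = trans (sym (+-suc (B * t) t₁)) (+-comm (B * t) t)

  boundary-separates : ∀ {a c : Fin N} B → toℕ a ≡ lo B → toℕ c ≡ hi B →
                       ∀ {x y} → deleteEdge G a c x y ≡ true → toℕ x < hi B → toℕ y < hi B
  boundary-separates {a} {c} B a≡lo c≡hi {x} {y} e x<hi
    with deleteEdge-sound G e | toℕ y <? hi B
  ... | _ , _ | yes y<hi = y<hi
  ... | xy , not-ac | no y≮hi with adjacent-witness xy
  ...   | path-down x≡1+y = <-trans (subst (toℕ y <_) (sym x≡1+y) (n<1+n (toℕ y))) x<hi
  ...   | path-up y≡1+x = contradiction (x≡a , y≡c) not-ac
    where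
    1+x≡hi : suc (toℕ x) ≡ hi B
    1+x≡hi = ≤-antisym x<hi (subst (hi B ≤_) y≡1+x (≮⇒≥ y≮hi))
    x≡a : x ≡ a
    x≡a = toℕ-injective (suc-injective (trans 1+x≡hi (trans (sym (suc-lo B)) (cong suc (sym a≡lo)))))
    y≡c : y ≡ c
    y≡c = toℕ-injective (trans y≡1+x (trans 1+x≡hi (sym c≡hi)))
  ...   | same-block x/t≡y/t _ = contradiction (m<n*o⇒m/o<n x<hi) (≤⇒≯ 1+B≤x/t)
    where
    1+B≤x/t : suc B ≤ toℕ x / t
    1+B≤x/t = subst₂ _≤_ (m*n/n≡m (suc B) t) (sym x/t≡y/t) (/-monoˡ-≤ t (≮⇒≥ y≮hi))

  crossing-edge : ∀ u → u / t ≢ suc u / t → u ≡ lo (u / t)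
  crossing-edge u crosses with u % t ≟ t₁
  ... | yes u%t≡t₁ = trans (position u) (cong (u / t * t +_) u%t≡t₁)
  ... | no u%t≢t₁ = contradiction (sym 1+u-in-block) crosses
    where
    -- otherwise u + 1 is still in u's block
    u%t<t₁ : u % t < t₁
    u%t<t₁ = ≤∧≢⇒< (≤-pred (m%n<n u t)) u%t≢t₁
    1+u≡ : suc u ≡ u / t * t + suc (u % t)
    1+u≡ = trans (cong suc (position u)) (sym (+-suc (u / t * t) (u % t)))
    1+u-in-block : suc u / t ≡ u / t
    1+u-in-block = trans (cong (_/ t) 1+u≡) (block-of (u / t) (suc (u % t)) (s≤s u%t<t₁))

  hi<N : ∀ (i : Fin k₁) → hi (toℕ i) < N
  hi<N i = +-monoʳ-< t (*-monoˡ-< t (toℕ<n i))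

  lo<N : ∀ (i : Fin k₁) → lo (toℕ i) < N
  lo<N i = <-trans (subst (lo (toℕ i) <_) (suc-lo (toℕ i)) (n<1+n _)) (hi<N i)

  boundary-edge : Fin k₁ → Fin N × Fin N
  boundary-edge i = fromℕ< (lo<N i) , fromℕ< (hi<N i)

  boundary-edges : List (Fin N × Fin N)
  boundary-edges = map boundary-edge (allFin k₁)

  boundary-edge-injective : ∀ {i j} → boundary-edge i ≡ boundary-edge j → i ≡ j
  boundary-edge-injective {i} {j} same =
    toℕ-injective (*-cancelʳ-≡ (toℕ i) (toℕ j) t (+-cancelʳ-≡ t₁ (toℕ i * t) (toℕ j * t) lo-same))
    where
    lo-same : lo (toℕ i) ≡ lo (toℕ j)
    lo-same = trans (sym (toℕ-fromℕ< (lo<N i)))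
                    (trans (cong (toℕ ∘ proj₁) same) (toℕ-fromℕ< (lo<N j)))

  boundary-edge-is-cut : ∀ i → IsCutEdge G (boundary-edge i)
  boundary-edge-is-cut i = (a<c , edge (path-up c≡1+a)) , disconnected
    where
    B = toℕ i
    a c : Fin N
    a = fromℕ< (lo<N i)
    c = fromℕ< (hi<N i)
    a≡lo : toℕ a ≡ lo B
    a≡lo = toℕ-fromℕ< (lo<N i)
    c≡hi : toℕ c ≡ hi B
    c≡hi = toℕ-fromℕ< (hi<N i)
    c≡1+a : toℕ c ≡ suc (toℕ a)
    c≡1+a = trans c≡hi (trans (sym (suc-lo B)) (cong suc (sym a≡lo)))
    a<c : toℕ a < toℕ c
    a<c = subst (toℕ a <_) (sym c≡1+a) (n<1+n (toℕ a))
    -- a walk from a to c would stay below hi B, but c = hi B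
    disconnected : ¬ ConnectedAdj (deleteEdge G a c)
    disconnected conn = <-irrefl c≡hi
      (walk-invariant (λ x → toℕ x < hi B) (boundary-separates B a≡lo c≡hi) (conn a c)
                      (subst (toℕ a <_) c≡hi a<c))

  -- With t ≥ 3 an edge inside a block lies on a triangle within the block.
  block-edge-not-cut : 3 ≤ t → ∀ (a c : Fin N) → toℕ a / t ≡ toℕ c / t →
                       ConnectedAdj (deleteEdge G a c)
  block-edge-not-cut 3≤t a c same with avoid-two (toℕ a % t) (toℕ c % t)
  ... | j , j<3 , j≢a , j≢c =
    triangle-edge-not-cut G connected
      (edge (same-block (sym (trans (cong (_/ t) w≡) (block-of B j j<t))) (≢-sym w≢a)))
      (edge (same-block (trans (cong (_/ t) w≡) (trans (block-of B j j<t) same)) w≢c))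
      (w≢a ∘ cong toℕ) (w≢c ∘ cong toℕ)
    where
    B = toℕ a / t
    j<t : j < t
    j<t = ≤-trans j<3 3≤t
    w<N : B * t + j < N
    w<N = <-≤-trans (+-monoʳ-< (B * t) j<t) (block-fits B (m<n*o⇒m/o<n (toℕ<n a)))
    w : Fin N
    w = fromℕ< w<N
    w≡ : toℕ w ≡ B * t + j
    w≡ = toℕ-fromℕ< w<N
    w≢a : toℕ w ≢ toℕ a
    w≢a w≡a = j≢a (offset-unique (toℕ a) j (trans (sym w≡a) w≡))
    w≢c : toℕ w ≢ toℕ c
    w≢c w≡c = j≢c (offset-unique (toℕ c) j (subst (λ b → toℕ c ≡ b * t + j) same (trans (sym w≡c) w≡)))

  -- Conversely, when t ≥ 3 every cut edge is a boundary edge: it cannot lie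
  -- inside a block, so it is a path edge between consecutive blocks.
  cut-edge-is-boundary : 3 ≤ t → ∀ e → IsCutEdge G e → e ∈ boundary-edges
  cut-edge-is-boundary 3≤t (a , c) ((a<c , ac) , disconnected) with toℕ a / t ≟ toℕ c / t
  ... | yes same = contradiction (block-edge-not-cut 3≤t a c same) disconnected
  ... | no different with adjacent-witness ac
  ...   | path-down a≡1+c   = contradiction (subst (toℕ c <_) (sym a≡1+c) (n<1+n (toℕ c))) (<-asym a<c)
  ...   | same-block same _ = contradiction same different
  ...   | path-up c≡1+a     = subst (_∈ boundary-edges) at-B (∈-map⁺ boundary-edge (∈-allFin (fromℕ< B<k₁)))
    where
    B = toℕ a / t
    a≡lo : toℕ a ≡ lo B
    a≡lo = crossing-edge (toℕ a) (subst (λ x → B ≢ x / t) c≡1+a different)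
    c≡hi : toℕ c ≡ hi B
    c≡hi = trans c≡1+a (trans (cong suc a≡lo) (suc-lo B))
    B<k₁ : B < k₁
    B<k₁ = ≤-pred (*-cancelʳ-< t (suc B) k (subst (_< N) c≡hi (toℕ<n c)))
    at-B : boundary-edge (fromℕ< B<k₁) ≡ (a , c)
    at-B = cong₂ _,_
      (toℕ-injective (trans (toℕ-fromℕ< (lo<N (fromℕ< B<k₁))) (trans (cong lo (toℕ-fromℕ< B<k₁)) (sym a≡lo))))
      (toℕ-injective (trans (toℕ-fromℕ< (hi<N (fromℕ< B<k₁))) (trans (cong hi (toℕ-fromℕ< B<k₁)) (sym c≡hi))))

  cut-edges : 3 ≤ t → HasExactlyCutEdges G k₁
  cut-edges 3≤t =
    boundary-edges ,
    Unique.map⁺ boundary-edge-injective (Unique.allFin⁺ k₁) ,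
    trans (length-map boundary-edge (allFin k₁)) (length-tabulate (λ i → i)) ,
    boundary-sound ,
    cut-edge-is-boundary 3≤t
    where
    boundary-sound : ∀ e → e ∈ boundary-edges → IsCutEdge G e
    boundary-sound e e∈ with ∈-map⁻ boundary-edge e∈
    ... | i , _ , refl = boundary-edge-is-cut i

average-degree : ∀ k t .{{_ : NonZero k}} → (k * suc t ∸ k) / k ≡ t
average-degree k t = begin
  (k * suc t ∸ k) / k     ≡⟨ cong (λ m → (m ∸ k) / k) (*-suc k t) ⟩
  (k + k * t ∸ k) / k     ≡⟨ cong (_/ k) (m+n∸m≡n k (k * t)) ⟩
  k * t / k               ≡⟨ cong (_/ k) (*-comm k t) ⟩
  t * k / k               ≡⟨ m*n/n≡m t k ⟩
  t                       ∎
  where open ≡-Reasoning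

theorem3p2 : (k t : ℕ) → (k≥3 : 3 ≤ k) → 3 ≤ t →
    Σ (Graph (k * t)) λ H →
      Connected H ×
      MinDegree H (_/_ (k * t ∸ k) k {{>-nonZero (≤-trans (s≤s z≤n) k≥3)}}) ×
      HasExactlyCutEdges H (k ∸ 1)
-- H is the block-path graph with k blocks of size t (the hypotheses exclude
-- k = 0 and t = 0).
theorem3p2 (suc k₁) (suc t₁) _ t≥3 =
  G ,
  connected ,
  subst (MinDegree G) (sym (average-degree (suc k₁) t₁)) (min-degree (≤-trans (s≤s (s≤s z≤n)) t≥3)) ,
  cut-edges t≥3
  where open BlockPath k₁ t₁
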